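{- Let $H$ be a graph, $k \ge 1$ an integer, and $K$ a $(k+1)$-VC certificate of $H$. Let $T$ be any DFS tree of $K$. Let $u, v$ be two nodes whose least common ancestor $w$ in $T$ lies within the top $k$ layers of $T$. If $w \ne u$ and $w \ne v$, then $u$ and $v$ are not adjacent in $H$.
   Context: Two nodes are $c$-node-connected in a graph if the graph contains $c$ internally node-disjoint paths between them (their node-connectivity is at least $c$). A subgraph $K$ of a graph $H$ on the same node set is an $s$-VC certificate of $H$ if for every pair of nodes that are $c$-node-connected in $H$, they are $c'$-node-connected in $K$ for some $c' \ge \min\{s, c\}$. The top $k$ layers of a rooted tree $T$ are the nodes at depth $0,1,\ldots,k-1$ (the root being at depth $0$). -}

module Defs where

open import Data.Nat using (ℕ; zero; suc; _<_; _≥_; _⊓_)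
open import Data.Fin using (Fin; _≟_)
open import Data.Bool using (Bool; true; false)
open import Data.Maybe using (Maybe; just; nothing)
open import Data.List using (List; []; _∷_)
open import Data.List.Membership.Propositional using (_∈_; _∉_)
open import Data.List.Relation.Unary.Unique.Propositional using (Unique)
open import Data.Product using (Σ; ∃; ∃-syntax; _×_; _,_)
open import Relation.Nullary using (¬_; yes; no)
open import Relation.Binary.PropositionalEquality using (_≡_; _≢_)
open import Relation.Binary.Construct.Closure.ReflexiveTransitive using (Star)

record Graph (n : ℕ) : Set where
  field
    adj    : Fin n → Fin n → Bool
    sym    : ∀ x y → adj x y ≡ adj y x
    irrefl : ∀ x → adj x x ≡ false
open Graph public

_⊆G_ : ∀ {n} → Graph n → Graph n → Set
K ⊆G H = ∀ x y → adj K x y ≡ true → adj H x y ≡ true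

data Walk {n} (G : Graph n) : Fin n → Fin n → List (Fin n) → Set where
  stop : ∀ {s} → Walk G s s (s ∷ [])
  step : ∀ {s x t xs} → adj G s x ≡ true → Walk G x t xs → Walk G s t (s ∷ xs)

IsPath : ∀ {n} → Graph n → Fin n → Fin n → List (Fin n) → Set
IsPath G s t xs = Walk G s t xs × Unique xs

init : ∀ {A : Set} → List A → List A
init []           = []
init (x ∷ [])     = []
init (x ∷ y ∷ xs) = x ∷ init (y ∷ xs)

inner : ∀ {A : Set} → List A → List A
inner []       = []
inner (x ∷ xs) = init xs

InternallyDisjoint : ∀ {n} → List (Fin n) → List (Fin n) → Set
InternallyDisjoint p q = ∀ x → x ∈ inner p → x ∉ inner q

NodeConnected : ∀ {n} → Graph n → ℕ → Fin n → Fin n → Set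
NodeConnected {n} G c s t =
  Σ (Fin c → List (Fin n)) λ ps →
      (∀ i → IsPath G s t (ps i))
    × (∀ i j → i ≢ j → ps i ≢ ps j × InternallyDisjoint (ps i) (ps j))

IsVCCertificate : ∀ {n} → ℕ → Graph n → Graph n → Set
IsVCCertificate {n} s H K =
  K ⊆G H ×
  (∀ (x y : Fin n) (c : ℕ) → NodeConnected H c x y →
     ∃[ c' ] (c' ≥ s ⊓ c × NodeConnected K c' x y))

-- DFS state: stack (current root-to-node path, top first),
-- visited marks, and parent pointers of the tree built so far.
record DFSState (n : ℕ) : Set where
  constructor ⟨_,_,_⟩
  field
    stack   : List (Fin n)
    visited : Fin n → Bool
    parent  : Fin n → Maybe (Fin n)

update : ∀ {n} {A : Set} → (Fin n → A) → Fin n → A → Fin n → A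
update f y a z with z ≟ y
... | yes _ = a
... | no  _ = f z

data DFSStep {n} (G : Graph n) : DFSState n → DFSState n → Set where
  push : ∀ {x y s vis par} → adj G x y ≡ true → vis y ≡ false →
         DFSStep G ⟨ x ∷ s , vis , par ⟩
                   ⟨ y ∷ x ∷ s , update vis y true , update par y (just x) ⟩
  pop  : ∀ {x s vis par} → (∀ y → adj G x y ≡ true → vis y ≡ true) →
         DFSStep G ⟨ x ∷ s , vis , par ⟩ ⟨ s , vis , par ⟩

initVisited : ∀ {n} → Fin n → Fin n → Bool
initVisited r z with z ≟ r
... | yes _ = true
... | no  _ = false

IsDFSTree : ∀ {n} → Graph n → Fin n → (Fin n → Maybe (Fin n)) → Set
IsDFSTree {n} G r par =
  Σ (Fin n → Bool) λ vis →
    Star (DFSStep G) ⟨ r ∷ [] , initVisited r , (λ _ → nothing) ⟩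
                     ⟨ [] , vis , par ⟩
    × (∀ z → vis z ≡ true)

data UpSteps {n} (par : Fin n → Maybe (Fin n)) : Fin n → Fin n → ℕ → Set where
  here : ∀ {x} → UpSteps par x x zero
  up   : ∀ {x y a d} → par x ≡ just y → UpSteps par y a d →
         UpSteps par x a (suc d)

Ancestor : ∀ {n} → (Fin n → Maybe (Fin n)) → Fin n → Fin n → Set
Ancestor par a x = ∃[ d ] UpSteps par x a d

IsLCA : ∀ {n} → (Fin n → Maybe (Fin n)) → Fin n → Fin n → Fin n → Set
IsLCA par u v w =
  Ancestor par w u × Ancestor par w v ×
  (∀ a → Ancestor par a u → Ancestor par a v → Ancestor par a w)

InTopLayers : ∀ {n} → (Fin n → Maybe (Fin n)) → Fin n → ℕ → Fin n → Set
InTopLayers par r k x = ∃[ d ] (UpSteps par x r d × d < k)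

-- In a DFS tree T of K every edge of K joins a node to one of its ancestors.
-- Let c be the child of w on the way to u.  A u–v path in K has to leave the
-- subtree of c, and the edge doing so lands on an ancestor of w; so the
-- depth(w) + 1 ≤ k ancestors of w meet every such path internally, and K has
-- at most k internally disjoint u–v paths.  If uv were an edge of H (it is not
-- one of K, as u and v are incomparable in T), c paths in K together with uv
-- would be c + 1 paths in H, which the certificate returns as c + 1 paths in K;
-- repeating this exceeds k.
module Submission where

open import Defs
open import Data.Nat using (ℕ; zero; suc; _≤_; _<_; _+_; z≤n; s≤s)
open import Data.Nat.Properties using (≤-trans; m≢1+n+m; ≤⇒≯; m≥n⇒m⊓n≡n)
open import Data.Fin using (Fin; _≟_)
open import Data.Fin.Properties using (injective⇒≤)
open import Data.Bool using (Bool; true; false)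
open import Data.Maybe using (Maybe; just; nothing)
open import Data.List using (List; []; _∷_; length; lookup)
open import Data.List.Membership.Propositional using (_∈_; _∉_)
open import Data.List.Relation.Unary.Any as Any using (index)
open import Data.List.Relation.Unary.Any.Properties using (lookup-index)
open import Data.List.Relation.Unary.AllPairs using ([]; _∷_)
open import Data.List.Relation.Unary.All using ([]; _∷_)
open import Data.List.Relation.Unary.Linked as Linked using (Linked; []; [-]; _∷_)
open import Data.Product using (∃-syntax; _×_; _,_; proj₁; proj₂)
open import Data.Sum using (_⊎_; inj₁; inj₂; swap)
import Data.Sum as Sum
open import Data.Empty using (⊥; ⊥-elim)
open import Relation.Nullary using (¬_; yes; no)
open import Relation.Binary.PropositionalEquality
  using (_≡_; _≢_; refl; cong; subst; trans) renaming (sym to ≡-sym)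
open import Relation.Binary.Construct.Closure.ReflexiveTransitive using (Star; ε; _◅_)

ParentMap : ℕ → Set
ParentMap n = Fin n → Maybe (Fin n)

ParentOf : ∀ {n} → ParentMap n → Fin n → Fin n → Set
ParentOf par x y = par x ≡ just y

update-≡ : ∀ {n} {A : Set} (f : Fin n → A) y a → update f y a y ≡ a
update-≡ f y a with y ≟ y
... | yes _ = refl
... | no y≢y = ⊥-elim (y≢y refl)

update-≢ : ∀ {n} {A : Set} (f : Fin n → A) y a {z} → z ≢ y → update f y a z ≡ f z
update-≢ f y a {z} z≢y with z ≟ y
... | yes z≡y = ⊥-elim (z≢y z≡y)
... | no _ = refl

update-true-mono : ∀ {n} (f : Fin n → Bool) y {z} → f z ≡ true → update f y true z ≡ true
update-true-mono f y {z} fz with z ≟ y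
... | yes _ = refl
... | no _  = fz

upSteps-trans : ∀ {n} {par : ParentMap n} {x a b d₁ d₂} →
                UpSteps par x a d₁ → UpSteps par a b d₂ → UpSteps par x b (d₁ + d₂)
upSteps-trans here    t = t
upSteps-trans (up p s) t = up p (upSteps-trans s t)

ancestor-trans : ∀ {n} {par : ParentMap n} {a b c} →
                 Ancestor par a b → Ancestor par b c → Ancestor par a c
ancestor-trans (_ , b→a) (_ , c→b) = _ , upSteps-trans c→b b→a

upSteps-zero : ∀ {n} {par : ParentMap n} {x a} → UpSteps par x a 0 → x ≡ a
upSteps-zero here = refl

upSteps-unsnoc : ∀ {n} {par : ParentMap n} {u w d} → UpSteps par u w (suc d) →
                 ∃[ c ] (ParentOf par c w × UpSteps par u c d)
upSteps-unsnoc {u = u} (up p here) = u , p , here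
upSteps-unsnoc (up p (up q s)) with upSteps-unsnoc (up q s)
... | c , c→w , u→c = c , c→w , up p u→c

ancestors-comparable : ∀ {n} {par : ParentMap n} {x a b d₁ d₂} →
                       UpSteps par x a d₁ → UpSteps par x b d₂ →
                       Ancestor par a b ⊎ Ancestor par b a
ancestors-comparable here     x→b      = inj₂ (_ , x→b)
ancestors-comparable x→a      here     = inj₁ (_ , x→a)
ancestors-comparable (up p s) (up q t) with trans (≡-sym p) q
... | refl = ancestors-comparable s t

upSteps-root-unique : ∀ {n} {par : ParentMap n} {r x d₁ d₂} → par r ≡ nothing →
                      UpSteps par x r d₁ → UpSteps par x r d₂ → d₁ ≡ d₂
upSteps-root-unique r∅ here     here     = refl
upSteps-root-unique r∅ here     (up p _) with trans (≡-sym p) r∅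
... | ()
upSteps-root-unique r∅ (up p _) here     with trans (≡-sym p) r∅
... | ()
upSteps-root-unique r∅ (up p s) (up q t) with trans (≡-sym p) q
... | refl = cong suc (upSteps-root-unique r∅ s t)

pathNodes : ∀ {n} {par : ParentMap n} {x a d} → UpSteps par x a d → List (Fin n)
pathNodes {x = x} here     = x ∷ []
pathNodes {x = x} (up _ s) = x ∷ pathNodes s

length-pathNodes : ∀ {n} {par : ParentMap n} {x a d} (s : UpSteps par x a d) →
                   length (pathNodes s) ≡ suc d
length-pathNodes here     = refl
length-pathNodes (up _ s) = cong suc (length-pathNodes s)

ancestor∈pathNodes : ∀ {n} {par : ParentMap n} {r x a d e} → par r ≡ nothing →
                     (x→r : UpSteps par x r d) → UpSteps par x a e → a ∈ pathNodes x→r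
ancestor∈pathNodes r∅ here     here     = Any.here refl
ancestor∈pathNodes r∅ here     (up p _) with trans (≡-sym p) r∅
... | ()
ancestor∈pathNodes r∅ (up p s) here     = Any.here refl
ancestor∈pathNodes r∅ (up p s) (up q t) with trans (≡-sym p) q
... | refl = Any.there (ancestor∈pathNodes r∅ s t)

record RootedTree {n} (par : ParentMap n) (r : Fin n) : Set where
  field
    root-parentless : par r ≡ nothing
    root-ancestor   : ∀ z → Ancestor par r z

module _ {n} {par : ParentMap n} {r} (T : RootedTree par r) where
  open RootedTree T

  no-cycle : ∀ {a m} → UpSteps par a a (suc m) → ⊥
  no-cycle {a} {m} a→a with root-ancestor a
  ... | d , a→r =
    m≢1+n+m d (≡-sym (upSteps-root-unique root-parentless (upSteps-trans a→a a→r) a→r))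

  ancestor-antisym : ∀ {a b} → Ancestor par a b → Ancestor par b a → a ≡ b
  ancestor-antisym (zero  , b→a) _          = ≡-sym (upSteps-zero b→a)
  ancestor-antisym (suc _ , b→a) (_ , a→b) = ⊥-elim (no-cycle (upSteps-trans b→a a→b))

  lca-incomparable : ∀ {u v w} → IsLCA par u v w → w ≢ u → w ≢ v →
                     ¬ Ancestor par u v × ¬ Ancestor par v u
  lca-incomparable (w≤u , w≤v , lca) w≢u w≢v =
      (λ u≤v → w≢u (ancestor-antisym w≤u (lca _ (0 , here) u≤v)))
    , (λ v≤u → w≢v (ancestor-antisym w≤v (lca _ v≤u (0 , here))))

-- Depth-first search trees have no cross edges

NoCrossEdges : ∀ {n} → Graph n → ParentMap n → Set
NoCrossEdges K par = ∀ x y → adj K x y ≡ true → Ancestor par x y ⊎ Ancestor par y x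

parentOf-update : ∀ {n} {par : ParentMap n} {y m x z} → par y ≡ nothing →
                  ParentOf par x z → ParentOf (update par y m) x z
parentOf-update {par = par} {y} {m} {x} y∅ x→z with x ≟ y
... | yes refl with trans (≡-sym x→z) y∅
...   | ()
parentOf-update y∅ x→z | no _ = x→z

upSteps-update : ∀ {n} {par : ParentMap n} {y m z a d} → par y ≡ nothing →
                 UpSteps par z a d → UpSteps (update par y m) z a d
upSteps-update y∅ here     = here
upSteps-update {par = par} {y} {m} y∅ (up p s) =
  up (parentOf-update {par = par} {y} {m} y∅ p) (upSteps-update y∅ s)

ancestor-update : ∀ {n} {par : ParentMap n} {y m a z} → par y ≡ nothing →
                  Ancestor par a z → Ancestor (update par y m) a z
ancestor-update y∅ (d , s) = d , upSteps-update y∅ s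

linked-ancestor : ∀ {n} {par : ParentMap n} {x z s} →
                  Linked (ParentOf par) (x ∷ s) → z ∈ s → Ancestor par z x
linked-ancestor (x→y ∷ _)  (Any.here refl) = 1 , up x→y here
linked-ancestor (x→y ∷ ps) (Any.there z∈s) with linked-ancestor ps z∈s
... | d , y→z = suc d , up x→y y→z

record DFSInvariant {n} (K : Graph n) (r : Fin n) (st : DFSState n) : Set where
  open DFSState st
  field
    root-visited          : visited r ≡ true
    root-parentless       : parent r ≡ nothing
    unvisited-parentless  : ∀ z → visited z ≡ false → parent z ≡ nothing
    visited-below-root    : ∀ z → visited z ≡ true → Ancestor parent r z
    stack-linked          : Linked (ParentOf parent) stack
    stack-visited         : ∀ z → z ∈ stack → visited z ≡ true
    finished-no-cross     : ∀ x → visited x ≡ true → x ∉ stack →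
                            ∀ y → adj K x y ≡ true →
                            Ancestor parent x y ⊎ Ancestor parent y x

module _ {n} {K : Graph n} {r : Fin n} where

  dfsInvariant-init : DFSInvariant K r ⟨ r ∷ [] , initVisited r , (λ _ → nothing) ⟩
  dfsInvariant-init = record
    { root-visited         = r-visited
    ; root-parentless      = refl
    ; unvisited-parentless = λ _ _ → refl
    ; visited-below-root   = λ _ z-visited →
                               subst (Ancestor _ r) (≡-sym (visited⇒≡r z-visited)) (0 , here)
    ; stack-linked         = [-]
    ; stack-visited        = λ { _ (Any.here refl) → r-visited }
    ; finished-no-cross    = λ x x-visited x∉ → ⊥-elim (x∉ (Any.here (visited⇒≡r x-visited)))
    }
    where
    r-visited : initVisited r r ≡ true
    r-visited with r ≟ r
    ... | yes _ = refl
    ... | no r≢r = ⊥-elim (r≢r refl)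
    visited⇒≡r : ∀ {z} → initVisited r z ≡ true → z ≡ r
    visited⇒≡r {z} z-visited with z ≟ r
    ... | yes z≡r = z≡r
    visited⇒≡r {z} () | no _

  dfsInvariant-push : ∀ {x y s vis par} → adj K x y ≡ true → vis y ≡ false →
                      DFSInvariant K r ⟨ x ∷ s , vis , par ⟩ →
                      DFSInvariant K r ⟨ y ∷ x ∷ s , update vis y true , update par y (just x) ⟩
  dfsInvariant-push {x} {y} {s} {vis} {par} _ y-unvisited I = record
    { root-visited         = trans (update-≢ vis y true r≢y) root-visited
    ; root-parentless      = trans (update-≢ par y (just x) r≢y) root-parentless
    ; unvisited-parentless = unvisited-parentless′
    ; visited-below-root   = visited-below-root′
    ; stack-linked         = update-≡ par y (just x)
                           ∷ Linked.map (parentOf-update {par = par} {y} {just x} y∅) stack-linked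
    ; stack-visited        = stack-visited′
    ; finished-no-cross    = finished-no-cross′
    }
    where
    open DFSInvariant I
    y∅ : par y ≡ nothing
    y∅ = unvisited-parentless y y-unvisited
    r≢y : r ≢ y
    r≢y refl with trans (≡-sym root-visited) y-unvisited
    ... | ()
    unvisited-parentless′ : ∀ z → update vis y true z ≡ false → update par y (just x) z ≡ nothing
    unvisited-parentless′ z z-unvisited with z ≟ y
    unvisited-parentless′ z () | yes _
    ... | no _ = unvisited-parentless z z-unvisited
    visited-below-root′ : ∀ z → update vis y true z ≡ true → Ancestor (update par y (just x)) r z
    visited-below-root′ z z-visited with z ≟ y
    ... | no _ = ancestor-update y∅ (visited-below-root z z-visited)
    ... | yes refl with visited-below-root x (stack-visited x (Any.here refl))
    ...   | d , x→r = suc d , up (update-≡ par y (just x)) (upSteps-update y∅ x→r)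
    stack-visited′ : ∀ z → z ∈ y ∷ x ∷ s → update vis y true z ≡ true
    stack-visited′ _ (Any.here refl)  = update-≡ vis y true
    stack-visited′ z (Any.there z∈)   = update-true-mono vis y (stack-visited z z∈)
    finished-no-cross′ : ∀ x′ → update vis y true x′ ≡ true → x′ ∉ y ∷ x ∷ s →
                         ∀ y′ → adj K x′ y′ ≡ true →
                         Ancestor (update par y (just x)) x′ y′ ⊎ Ancestor (update par y (just x)) y′ x′
    finished-no-cross′ x′ x′-visited x′∉ y′ e =
      Sum.map (ancestor-update y∅) (ancestor-update y∅)
        (finished-no-cross x′ (trans (≡-sym (update-≢ vis y true x′≢y)) x′-visited)
                           (λ x′∈ → x′∉ (Any.there x′∈)) y′ e)
      where
      x′≢y : x′ ≢ y
      x′≢y x′≡y = x′∉ (Any.here x′≡y)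

  dfsInvariant-pop : ∀ {x s vis par} → (∀ y → adj K x y ≡ true → vis y ≡ true) →
                     DFSInvariant K r ⟨ x ∷ s , vis , par ⟩ → DFSInvariant K r ⟨ s , vis , par ⟩
  dfsInvariant-pop {x} {s} {vis} {par} neighbours-visited I = record
    { root-visited         = root-visited
    ; root-parentless      = root-parentless
    ; unvisited-parentless = unvisited-parentless
    ; visited-below-root   = visited-below-root
    ; stack-linked         = Linked.tail stack-linked
    ; stack-visited        = λ z z∈ → stack-visited z (Any.there z∈)
    ; finished-no-cross    = finished-no-cross′
    }
    where
    open DFSInvariant I
    -- Every neighbour of the popped node x is visited: it is either still on
    -- the stack, hence an ancestor of x, or already popped itself.
    finished-no-cross′ : ∀ x′ → vis x′ ≡ true → x′ ∉ s → ∀ y → adj K x′ y ≡ true →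
                         Ancestor par x′ y ⊎ Ancestor par y x′
    finished-no-cross′ x′ x′-visited x′∉ y e with x′ ≟ x
    ... | no x′≢x = finished-no-cross x′ x′-visited
                      (λ { (Any.here x′≡x) → x′≢x x′≡x ; (Any.there x′∈) → x′∉ x′∈ }) y e
    ... | yes refl with Any.any? (y ≟_) (x ∷ s)
    ...   | yes (Any.here refl) with trans (≡-sym e) (irrefl K x)
    ...     | ()
    finished-no-cross′ x′ x′-visited x′∉ y e | yes refl | yes (Any.there y∈s) =
      inj₂ (linked-ancestor stack-linked y∈s)
    finished-no-cross′ x′ x′-visited x′∉ y e | yes refl | no y∉ =
      swap (finished-no-cross y (neighbours-visited y e) y∉ x′ (trans (sym K y x′) e))

  dfsInvariant-run : ∀ {st st′} → Star (DFSStep K) st st′ →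
                     DFSInvariant K r st → DFSInvariant K r st′
  dfsInvariant-run ε                   I = I
  dfsInvariant-run (push e y∉ ◅ steps) I = dfsInvariant-run steps (dfsInvariant-push e y∉ I)
  dfsInvariant-run (pop all ◅ steps)   I = dfsInvariant-run steps (dfsInvariant-pop all I)

  module _ {par : ParentMap n} (dfs : IsDFSTree K r par) where
    private
      all-visited : ∀ z → proj₁ dfs z ≡ true
      all-visited = proj₂ (proj₂ dfs)
      open DFSInvariant (dfsInvariant-run (proj₁ (proj₂ dfs)) dfsInvariant-init)

    IsDFSTree⇒RootedTree : RootedTree par r
    IsDFSTree⇒RootedTree = record
      { root-parentless = root-parentless
      ; root-ancestor   = λ z → visited-below-root z (all-visited z)
      }

    IsDFSTree⇒NoCrossEdges : NoCrossEdges K par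
    IsDFSTree⇒NoCrossEdges x = finished-no-cross x (all-visited x) (λ ())

disjoint-paths≤separator : ∀ {n c} (ps : Fin c → List (Fin n)) (S : List (Fin n)) →
                           (∀ i j → i ≢ j → InternallyDisjoint (ps i) (ps j)) →
                           (∀ i → ∃[ y ] (y ∈ inner (ps i) × y ∈ S)) → c ≤ length S
disjoint-paths≤separator ps S disjoint meets = injective⇒≤ {f = slot} slot-injective
  where
  slot : _ → Fin (length S)
  slot i = index (proj₂ (proj₂ (meets i)))
  slot-injective : ∀ {i j} → slot i ≡ slot j → i ≡ j
  slot-injective {i} {j} slots≡ with i ≟ j
  ... | yes i≡j = i≡j
  ... | no i≢j with meets i | meets j | lookup-index (proj₂ (proj₂ (meets i)))
                                      | lookup-index (proj₂ (proj₂ (meets j)))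
  ...   | y , y∈i , y∈S | y′ , y′∈j , y′∈S | y≡ | y′≡ =
    ⊥-elim (disjoint i j i≢j y y∈i (subst (_∈ inner (ps j)) y′≡y y′∈j))
    where
    y′≡y : y′ ≡ y
    y′≡y = trans y′≡ (trans (cong (lookup S) (≡-sym slots≡)) (≡-sym y≡))

walk-head : ∀ {n} {G : Graph n} {s t xs} → Walk G s t xs → s ∈ xs
walk-head stop       = Any.here refl
walk-head (step _ _) = Any.here refl

∈-init : ∀ {n} {G : Graph n} {x t y xs} → Walk G x t xs → y ∈ xs → y ≢ t → y ∈ init xs
∈-init stop                  (Any.here y≡t)              y≢t = ⊥-elim (y≢t y≡t)
∈-init (step _ stop)         (Any.here y≡x)              _   = Any.here y≡x
∈-init (step _ stop)         (Any.there (Any.here y≡t))  y≢t = ⊥-elim (y≢t y≡t)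
∈-init (step _ (step _ _))   (Any.here y≡x)              _   = Any.here y≡x
∈-init (step _ w@(step _ _)) (Any.there y∈)              y≢t = Any.there (∈-init w y∈ y≢t)

∈-inner : ∀ {n} {G : Graph n} {s t y xs} → Walk G s t xs → y ∈ xs → y ≢ s → y ≢ t → y ∈ inner xs
∈-inner stop       (Any.here y≡s)  y≢s _   = ⊥-elim (y≢s y≡s)
∈-inner (step _ _) (Any.here y≡s)  y≢s _   = ⊥-elim (y≢s y≡s)
∈-inner (step _ w) (Any.there y∈)  _   y≢t = ∈-init w y∈ y≢t

nodeConnected-zero : ∀ {n} (G : Graph n) s t → NodeConnected G 0 s t
nodeConnected-zero G s t = (λ ()) , (λ ()) , (λ ())

nodeConnected-addEdge : ∀ {n} {H K : Graph n} {u v c} → K ⊆G H →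
                        adj H u v ≡ true → adj K u v ≡ false →
                        NodeConnected K c u v → NodeConnected H (suc c) u v
nodeConnected-addEdge {n} {H} {K} {u} {v} {c} K⊆H uv∈H uv∉K (ps , paths , disjoint) =
  ps′ , paths′ , disjoint′
  where
  u≢v : u ≢ v
  u≢v refl with trans (≡-sym uv∈H) (irrefl H u)
  ... | ()
  walk-⊆ : ∀ {s t xs} → Walk K s t xs → Walk H s t xs
  walk-⊆ stop       = stop
  walk-⊆ (step e w) = step (K⊆H _ _ e) (walk-⊆ w)
  ps≢edge : ∀ i → ps i ≢ u ∷ v ∷ []
  ps≢edge i psᵢ≡ with subst (Walk K u v) psᵢ≡ (proj₁ (paths i))
  ... | step e stop with trans (≡-sym e) uv∉K
  ...   | ()
  ps′ : Fin (suc c) → List (Fin n)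
  ps′ Fin.zero    = u ∷ v ∷ []
  ps′ (Fin.suc i) = ps i
  paths′ : ∀ i → IsPath H u v (ps′ i)
  paths′ Fin.zero    = step uv∈H stop , (u≢v ∷ []) ∷ [] ∷ []
  paths′ (Fin.suc i) = walk-⊆ (proj₁ (paths i)) , proj₂ (paths i)
  disjoint′ : ∀ i j → i ≢ j → ps′ i ≢ ps′ j × InternallyDisjoint (ps′ i) (ps′ j)
  disjoint′ Fin.zero    Fin.zero    i≢j = ⊥-elim (i≢j refl)
  disjoint′ Fin.zero    (Fin.suc j) _   = (λ e → ps≢edge j (≡-sym e)) , (λ _ ())
  disjoint′ (Fin.suc i) Fin.zero    _   = ps≢edge i , (λ _ _ ())
  disjoint′ (Fin.suc i) (Fin.suc j) i≢j = disjoint i j (λ i≡j → i≢j (cong Fin.suc i≡j))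

certificate-edge-unbounded : ∀ {n} {H K : Graph n} {s u v} → IsVCCertificate s H K →
                             adj H u v ≡ true → adj K u v ≡ false →
                             ¬ (∀ {c} → NodeConnected K c u v → c < s)
certificate-edge-unbounded {K = K} {s} {u} {v} (K⊆H , connectivity) uv∈H uv∉K bounded =
  let c , s≤c , conn = at-least s in ≤⇒≯ s≤c (bounded conn)
  where
  at-least : ∀ m → ∃[ c ] (m ≤ c × NodeConnected K c u v)
  at-least zero = 0 , z≤n , nodeConnected-zero K u v
  at-least (suc m) with at-least m
  ... | c , m≤c , conn with connectivity _ _ (suc c) (nodeConnected-addEdge K⊆H uv∈H uv∉K conn)
  ...   | c′ , c′≥ , conn′ =
    c′ , ≤-trans (s≤s m≤c) (subst (_≤ c′) (m≥n⇒m⊓n≡n (bounded conn)) c′≥) , conn′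

-- The ancestors of a least common ancestor separate its two branches

module _ {n} {K : Graph n} {par : ParentMap n} (noCross : NoCrossEdges K par) where

  -- An edge leading up from x ends on an ancestor of x, which is comparable with c.
  edge-stays-below-or-above-parent : ∀ {c w x x′} → ParentOf par c w → adj K x x′ ≡ true →
                                     Ancestor par c x → Ancestor par c x′ ⊎ Ancestor par x′ w
  edge-stays-below-or-above-parent c→w e c≤x with noCross _ _ e
  ... | inj₁ x≤x′ = inj₁ (ancestor-trans c≤x x≤x′)
  ... | inj₂ (_ , x→x′) with ancestors-comparable (proj₂ c≤x) x→x′
  ...   | inj₁ c≤x′              = inj₁ c≤x′
  ...   | inj₂ (zero  , here)    = inj₁ (0 , here)
  ...   | inj₂ (suc m , up p s) with trans (≡-sym p) c→w
  ...     | refl = inj₂ (m , s)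

  walk-exits-subtree : ∀ {c w x t xs} → ParentOf par c w → Walk K x t xs →
                       Ancestor par c x → ¬ Ancestor par c t → ∃[ y ] (y ∈ xs × Ancestor par y w)
  walk-exits-subtree c→w stop c≤x c≰t = ⊥-elim (c≰t c≤x)
  walk-exits-subtree c→w (step {x = x′} e rest) c≤x c≰t
    with edge-stays-below-or-above-parent c→w e c≤x
  ... | inj₂ x′≤w = x′ , Any.there (walk-head rest) , x′≤w
  ... | inj₁ c≤x′ with walk-exits-subtree c→w rest c≤x′ c≰t
  ...   | y , y∈ , y≤w = y , Any.there y∈ , y≤w

  module _ {r} (T : RootedTree par r) {u v w} (isLCA : IsLCA par u v w)
           (w≢u : w ≢ u) (w≢v : w ≢ v) where

    private
      u≰v : ¬ Ancestor par u v
      u≰v = proj₁ (lca-incomparable T isLCA w≢u w≢v)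
      v≰u : ¬ Ancestor par v u
      v≰u = proj₂ (lca-incomparable T isLCA w≢u w≢v)

    lca-nonadjacent : adj K u v ≡ false
    lca-nonadjacent with adj K u v in e
    ... | false = refl
    ... | true with noCross u v e
    ...   | inj₁ u≤v = ⊥-elim (u≰v u≤v)
    ...   | inj₂ v≤u = ⊥-elim (v≰u v≤u)

    lca-child-above-u : ∃[ c ] (ParentOf par c w × Ancestor par c u × ¬ Ancestor par c v)
    lca-child-above-u with proj₁ isLCA
    ... | zero  , u→w = ⊥-elim (w≢u (≡-sym (upSteps-zero u→w)))
    ... | suc d , u→w with upSteps-unsnoc u→w
    ...   | c , c→w , u→c = c , c→w , (d , u→c) , c≰v
      where
      c≰v : ¬ Ancestor par c v
      c≰v c≤v with proj₂ (proj₂ isLCA) c (d , u→c) c≤v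
      ... | _ , w→c = no-cycle T (up c→w w→c)

    walk-meets-lca-ancestor : ∀ {xs} → Walk K u v xs → ∃[ y ] (y ∈ inner xs × Ancestor par y w)
    walk-meets-lca-ancestor walk with lca-child-above-u
    ... | c , c→w , c≤u , c≰v with walk-exits-subtree c→w walk c≤u c≰v
    ...   | y , y∈ , y≤w = y , ∈-inner walk y∈ y≢u y≢v , y≤w
      where
      y≢u : y ≢ u
      y≢u refl = u≰v (ancestor-trans y≤w (proj₁ (proj₂ isLCA)))
      y≢v : y ≢ v
      y≢v refl = v≰u (ancestor-trans y≤w (proj₁ isLCA))

    lca-connectivity≤depth : ∀ {d c} → UpSteps par w r d → NodeConnected K c u v → c ≤ suc d
    lca-connectivity≤depth w→r (ps , paths , disjoint) =
      subst (_ ≤_) (length-pathNodes w→r)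
        (disjoint-paths≤separator ps (pathNodes w→r) (λ i j i≢j → proj₂ (disjoint i j i≢j))
          λ i → let y , y∈ , (_ , w→y) = walk-meets-lca-ancestor (proj₁ (paths i))
                in y , y∈ , ancestor∈pathNodes (RootedTree.root-parentless T) w→r w→y)

lemma16 : ∀ {n} (H K : Graph n) (k : ℕ) → 1 ≤ k →
    IsVCCertificate (suc k) H K →
    (r : Fin n) (par : Fin n → Maybe (Fin n)) → IsDFSTree K r par →
    (u v w : Fin n) → IsLCA par u v w → InTopLayers par r k w →
    w ≢ u → w ≢ v → adj H u v ≡ false
lemma16 H K k _ cert r par dfs u v w isLCA (d , w→r , d<k) w≢u w≢v with adj H u v in uv∈H
... | false = refl
... | true = ⊥-elim (certificate-edge-unbounded cert uv∈H uv∉K bounded)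
  where
  T : RootedTree par r
  T = IsDFSTree⇒RootedTree dfs
  noCross : NoCrossEdges K par
  noCross = IsDFSTree⇒NoCrossEdges dfs
  uv∉K : adj K u v ≡ false
  uv∉K = lca-nonadjacent {K = K} noCross T isLCA w≢u w≢v
  bounded : ∀ {c} → NodeConnected K c u v → c < suc k
  bounded conn = s≤s (≤-trans (lca-connectivity≤depth {K = K} noCross T isLCA w≢u w≢v w→r conn) d<k)
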